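{- Let $G$ be a cubic graph and let $T$ be a triangle in $G$. Then in any orientation $D$ of $G$, at least one vertex $u$ of $T$ is bad, i.e., satisfies $\theta_D(u,v)\le 2$ for all vertices $v\in V(G)\setminus V(T)$.
   Context: Graphs are finite and simple; a cubic graph is $3$-regular. An orientation of $G$ is obtained by directing each edge. For a digraph $D$ and distinct vertices $u,v$, $\kappa_D(u,v)$ is the maximum number of internally disjoint directed $u$--$v$ paths, and $\theta_D(u,v)=\kappa_D(u,v)+\kappa_D(v,u)$. -}

module Defs where

open import Data.Nat using (ℕ; _+_; _≤_)
open import Data.Fin using (Fin)
open import Data.Bool using (Bool; true; false; T)
open import Data.List using (List; []; _∷_; _++_; length; filterᵇ; allFin)
open import Data.List.Relation.Unary.Linked using (Linked)
open import Data.List.Relation.Unary.Unique.Propositional using (Unique)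
open import Data.List.Relation.Binary.Disjoint.Propositional using (Disjoint)
open import Data.Product using (_×_; Σ)
open import Data.Sum using (_⊎_)
open import Relation.Binary.PropositionalEquality using (_≡_; _≢_)
open import Relation.Nullary using (¬_)

record Graph (n : ℕ) : Set where
  field
    adj   : Fin n → Fin n → Bool
    irrefl : ∀ x → adj x x ≡ false
    sym   : ∀ x y → adj x y ≡ adj y x
open Graph public

degree : ∀ {n} → Graph n → Fin n → ℕ
degree G v = length (filterᵇ (adj G v) (allFin _))

Cubic : ∀ {n} → Graph n → Set
Cubic G = ∀ v → degree G v ≡ 3

IsTriangle : ∀ {n} → Graph n → Fin n → Fin n → Fin n → Set
IsTriangle G a b c =
  (a ≢ b) × (b ≢ c) × (a ≢ c) ×
  (adj G a b ≡ true) × (adj G b c ≡ true) × (adj G a c ≡ true)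

Digraph : ℕ → Set
Digraph n = Fin n → Fin n → Bool

IsOrientation : ∀ {n} → Graph n → Digraph n → Set
IsOrientation G D =
  (∀ x y → D x y ≡ true → adj G x y ≡ true) ×
  (∀ x y → adj G x y ≡ true →
     (D x y ≡ true × D y x ≡ false) ⊎ (D x y ≡ false × D y x ≡ true))

IsDiPath : ∀ {n} → Digraph n → Fin n → Fin n → List (Fin n) → Set
IsDiPath D u v mid =
  Unique (u ∷ mid ++ v ∷ []) × Linked (λ x y → D x y ≡ true) (u ∷ mid ++ v ∷ [])

HasDisjointPaths : ∀ {n} → Digraph n → Fin n → Fin n → ℕ → Set
HasDisjointPaths {n} D u v k =
  Σ (Fin k → List (Fin n)) λ P →
    (∀ i → IsDiPath D u v (P i)) ×
    (∀ i j → i ≢ j → (P i ≢ P j) × Disjoint (P i) (P j))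

-- θ_D(u,v) ≤ m, where θ_D(u,v) = κ_D(u,v) + κ_D(v,u) and κ_D is the maximum
-- number of internally disjoint directed paths: unfolded as
-- "any such families of sizes k₁ (u→v) and k₂ (v→u) satisfy k₁ + k₂ ≤ m".
θ≤ : ∀ {n} → Digraph n → Fin n → Fin n → ℕ → Set
θ≤ D u v m =
  ∀ k₁ k₂ → HasDisjointPaths D u v k₁ → HasDisjointPaths D v u k₂ → k₁ + k₂ ≤ m

Bad : ∀ {n} → Digraph n → Fin n → Fin n → Fin n → Fin n → Set
Bad D a b c u = ∀ v → v ≢ a → v ≢ b → v ≢ c → θ≤ D u v 2

-- Fix u in T and v outside T. Distinct internally disjoint paths share no arc, and every
-- u→v path leaves both {u} and T along an arc, so κ(u,v) ≤ min(d⁺(u), e⁺), where e⁺ counts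
-- the arcs from T to the rest of G; symmetrically κ(v,u) ≤ min(d⁻(u), e⁻). In a cubic graph
-- every triangle vertex has exactly one neighbour off T, so d⁺(u) + d⁻(u) = 3 = e⁺ + e⁻, and
-- θ(u,v) ≤ 2 as soon as d⁺(u) ≠ e⁺. Each triangle edge is an out-arc of exactly one of a, b, c,
-- so d⁺(a) + d⁺(b) + d⁺(c) = 3 + e⁺, and by parity d⁺(u) = e⁺ cannot hold for all three.
module Submission where

open import Defs hiding (sym)
open import Algebra.Properties.CommutativeSemigroup
  using (interchange)
open import Data.Bool using (true)
open import Data.Bool.Properties using (T-≡)
open import Data.Empty using (⊥-elim)
open import Data.Fin using (Fin; _≟_)
open import Data.Fin.Properties using (injective⇒≤)
open import Data.List using (List; []; _∷_; _++_; length; lookup; map; filterᵇ; allFin)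
open import Data.List.Membership.Propositional using (_∈_)
open import Data.List.Membership.Propositional.Properties
  using (∈-++⁺ˡ; ∈-++⁺ʳ; ∈-map⁺; ∈-filter⁺; ∈-filter⁻; ∈-allFin)
open import Data.List.Properties using (filter-++; length-++)
open import Data.List.Relation.Binary.Disjoint.Propositional using (Disjoint)
open import Data.List.Relation.Unary.All using (All; []; _∷_)
open import Data.List.Relation.Unary.AllPairs using (_∷_)
open import Data.List.Relation.Unary.Any using (here; there; index)
open import Data.List.Relation.Unary.Any.Properties using (lookup-index)
open import Data.List.Relation.Unary.Linked using (Linked; [-]; _∷_)
open import Data.List.Relation.Unary.Unique.Propositional using (Unique)
open import Data.List.Relation.Unary.Unique.Propositional.Properties using (Unique[x∷xs]⇒x∉xs)
open import Data.Nat using (ℕ; zero; suc; _+_; _≤_; z≤n; s≤s)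
open import Data.Nat.Properties
  using (+-commutativeSemigroup; +-cancelʳ-≡; +-mono-≤; +-monoˡ-<; <-cmp; <⇒≢; ≤-pred; ≤-trans; m≤n+m; module ≤-Reasoning)
  renaming (_≟_ to _≟ℕ_)
open import Data.Nat.Tactic.RingSolver using (solve-∀)
open import Data.Product using (Σ; _×_; _,_; proj₁; proj₂; swap; uncurry)
open import Data.Sum using (_⊎_; inj₁; inj₂; [_,_]′)
open import Function using (_∘_; id; case_of_)
open import Function.Bundles using (Equivalence)
open import Level using (Level)
open import Relation.Binary using (Rel; tri<; tri≈; tri>)
open import Relation.Binary.PropositionalEquality using (_≡_; _≢_; refl; sym; trans; cong; cong₂; subst; module ≡-Reasoning)
open import Relation.Nullary using (¬_; yes; no; ¬?)
open import Relation.Nullary.Decidable using (T?; _⊎-dec_; decidable-stable)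
open import Relation.Unary using (Pred; Decidable)

private
  variable
    ℓ p r : Level

module _ {A : Set ℓ} where

  pigeonhole-∈ : ∀ {k} (f : Fin k → A) → (∀ {i j} → i ≢ j → f i ≢ f j) →
                 (xs : List A) → (∀ i → f i ∈ xs) → k ≤ length xs
  pigeonhole-∈ f f-distinct xs f∈xs = injective⇒≤ position-injective
    where
    position-injective : ∀ {i j} → index (f∈xs i) ≡ index (f∈xs j) → i ≡ j
    position-injective {i} {j} same-position with i ≟ j
    ... | yes i≡j = i≡j
    ... | no i≢j  = ⊥-elim (f-distinct i≢j (begin
      f i                           ≡⟨ lookup-index (f∈xs i) ⟩
      lookup xs (index (f∈xs i))    ≡⟨ cong (lookup xs) same-position ⟩
      lookup xs (index (f∈xs j))    ≡⟨ sym (lookup-index (f∈xs j)) ⟩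
      f j                           ∎))
      where open ≡-Reasoning

  third-element : ∀ {x y} (xs : List A) → length xs ≡ 3 → x ∈ xs → y ∈ xs → x ≢ y →
    Σ A λ z → z ∈ xs × (∀ {w} → w ∈ xs → w ≡ x ⊎ w ≡ y ⊎ w ≡ z)
  third-element (x₀ ∷ x₁ ∷ x₂ ∷ []) refl = select
    where
    L = x₀ ∷ x₁ ∷ x₂ ∷ []
    select : ∀ {x y} → x ∈ L → y ∈ L → x ≢ y →
      Σ _ λ z → z ∈ L × (∀ {w} → w ∈ L → w ≡ x ⊎ w ≡ y ⊎ w ≡ z)
    select (here refl) (here refl) x≢y = ⊥-elim (x≢y refl)
    select (there (here refl)) (there (here refl)) x≢y = ⊥-elim (x≢y refl)
    select (there (there (here refl))) (there (there (here refl))) x≢y = ⊥-elim (x≢y refl)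
    select (here refl) (there (here refl)) _ = x₂ , there (there (here refl)) , λ
      { (here e) → inj₁ e ; (there (here e)) → inj₂ (inj₁ e) ; (there (there (here e))) → inj₂ (inj₂ e) }
    select (there (here refl)) (here refl) _ = x₂ , there (there (here refl)) , λ
      { (here e) → inj₂ (inj₁ e) ; (there (here e)) → inj₁ e ; (there (there (here e))) → inj₂ (inj₂ e) }
    select (here refl) (there (there (here refl))) _ = x₁ , there (here refl) , λ
      { (here e) → inj₁ e ; (there (here e)) → inj₂ (inj₂ e) ; (there (there (here e))) → inj₂ (inj₁ e) }
    select (there (there (here refl))) (here refl) _ = x₁ , there (here refl) , λ
      { (here e) → inj₂ (inj₁ e) ; (there (here e)) → inj₂ (inj₂ e) ; (there (there (here e))) → inj₁ e }
    select (there (here refl)) (there (there (here refl))) _ = x₀ , here refl , λ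
      { (here e) → inj₂ (inj₂ e) ; (there (here e)) → inj₁ e ; (there (there (here e))) → inj₂ (inj₁ e) }
    select (there (there (here refl))) (there (here refl)) _ = x₀ , here refl , λ
      { (here e) → inj₂ (inj₂ e) ; (there (here e)) → inj₂ (inj₁ e) ; (there (there (here e))) → inj₁ e }

  data Consecutive : A × A → List A → Set ℓ where
    here  : ∀ {x y xs} → Consecutive (x , y) (x ∷ y ∷ xs)
    there : ∀ {e z xs} → Consecutive e xs → Consecutive e (z ∷ xs)

  Linked⇒related : ∀ {R : Rel A r} {x y xs} → Linked R xs → Consecutive (x , y) xs → R x y
  Linked⇒related (Rxy ∷ _) here      = Rxy
  Linked⇒related (_ ∷ l)   (there c) = Linked⇒related l c
  Linked⇒related [-]       (there ())

  exit-step : ∀ {P : Pred A p} → Decidable P → ∀ s m t → P s → ¬ P t →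
    Σ (A × A) λ e → Consecutive e (s ∷ m ++ t ∷ []) × P (proj₁ e) × ¬ P (proj₂ e)
  exit-step P? s []      t Ps ¬Pt = (s , t) , here , Ps , ¬Pt
  exit-step P? s (w ∷ m) t Ps ¬Pt with P? w
  ... | no ¬Pw = (s , w) , here , Ps , ¬Pw
  ... | yes Pw with exit-step P? w m t Pw ¬Pt
  ...   | e , c , Px , ¬Py = e , there c , Px , ¬Py

  headOr : A → List A → A
  headOr t []      = t
  headOr t (w ∷ _) = w

  Consecutive-init : ∀ {x y m t} → Consecutive (x , y) (m ++ t ∷ []) → x ∈ m
  Consecutive-init {m = []}    (there ())
  Consecutive-init {m = _ ∷ []}    here = here refl
  Consecutive-init {m = _ ∷ _ ∷ _} here = here refl
  Consecutive-init {m = _ ∷ _} (there c) = there (Consecutive-init c)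

  Consecutive-path : ∀ {x y s m t} → Consecutive (x , y) (s ∷ m ++ t ∷ []) →
    (x ≡ s × y ≡ headOr t m) ⊎ x ∈ m
  Consecutive-path {m = []}    here      = inj₁ (refl , refl)
  Consecutive-path {m = _ ∷ _} here      = inj₁ (refl , refl)
  Consecutive-path             (there c) = inj₂ (Consecutive-init c)

  distinct-paths-diverge : ∀ {s t} m₁ m₂ → Unique (s ∷ m₁ ++ t ∷ []) → Unique (s ∷ m₂ ++ t ∷ []) →
    m₁ ≢ m₂ → Disjoint m₁ m₂ → headOr t m₁ ≢ headOr t m₂
  distinct-paths-diverge []       []       _        _        m₁≢m₂ _        _     = m₁≢m₂ refl
  distinct-paths-diverge []       (w ∷ m₂) _        (_ ∷ U₂) _     _        t≡w   =
    Unique[x∷xs]⇒x∉xs U₂ (∈-++⁺ʳ m₂ (here (sym t≡w)))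
  distinct-paths-diverge (w ∷ m₁) []       (_ ∷ U₁) _        _     _        w≡t   =
    Unique[x∷xs]⇒x∉xs U₁ (∈-++⁺ʳ m₁ (here w≡t))
  distinct-paths-diverge (_ ∷ _)  (_ ∷ _)  _        _        _     disjoint w≡w′ =
    disjoint (here refl , here w≡w′)

  distinct-paths-share-no-step : ∀ {s t m₁ m₂ e} →
    Unique (s ∷ m₁ ++ t ∷ []) → Unique (s ∷ m₂ ++ t ∷ []) → m₁ ≢ m₂ → Disjoint m₁ m₂ →
    Consecutive e (s ∷ m₁ ++ t ∷ []) → ¬ Consecutive e (s ∷ m₂ ++ t ∷ [])
  distinct-paths-share-no-step {m₁ = m₁} {m₂} {x , y} U₁ U₂ m₁≢m₂ disjoint c₁ c₂
    with Consecutive-path c₁ | Consecutive-path c₂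
  ... | inj₁ (refl , y≡₁) | inj₁ (_ , y≡₂)  = distinct-paths-diverge m₁ m₂ U₁ U₂ m₁≢m₂ disjoint (trans (sym y≡₁) y≡₂)
  ... | inj₁ (refl , _)   | inj₂ s∈m₂       = Unique[x∷xs]⇒x∉xs U₂ (∈-++⁺ˡ s∈m₂)
  ... | inj₂ s∈m₁         | inj₁ (refl , _) = Unique[x∷xs]⇒x∉xs U₁ (∈-++⁺ˡ s∈m₁)
  ... | inj₂ x∈m₁         | inj₂ x∈m₂       = disjoint (x∈m₁ , x∈m₂)

arcsIn : ∀ {n} → Digraph n → List (Fin n × Fin n) → List (Fin n × Fin n)
arcsIn E = filterᵇ (uncurry E)

disjoint-paths≤cut : ∀ {n} (E : Digraph n) {P : Pred (Fin n) p} → Decidable P →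
  ∀ {s t k} → P s → ¬ P t → HasDisjointPaths E s t k →
  (es : List (Fin n × Fin n)) → (∀ {x y} → P x → ¬ P y → E x y ≡ true → (x , y) ∈ es) →
  k ≤ length (arcsIn E es)
disjoint-paths≤cut {n = n} E {P} P? {s} {t} {k} Ps ¬Pt (path , is-path , disjoint) es covers =
  pigeonhole-∈ exit exits-distinct (arcsIn E es) exit∈arcs
  where
  exit-data : ∀ i → Σ (Fin n × Fin n) λ e →
    Consecutive e (s ∷ path i ++ t ∷ []) × P (proj₁ e) × ¬ P (proj₂ e)
  exit-data i = exit-step P? s (path i) t Ps ¬Pt

  exit : Fin k → Fin n × Fin n
  exit i = proj₁ (exit-data i)

  exits-distinct : ∀ {i j} → i ≢ j → exit i ≢ exit j
  exits-distinct {i} {j} i≢j same-exit =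
    distinct-paths-share-no-step (proj₁ (is-path i)) (proj₁ (is-path j))
      (proj₁ (disjoint i j i≢j)) (proj₂ (disjoint i j i≢j))
      (proj₁ (proj₂ (exit-data i)))
      (subst (λ e → Consecutive e _) (sym same-exit) (proj₁ (proj₂ (exit-data j))))

  exit∈arcs : ∀ i → exit i ∈ arcsIn E es
  exit∈arcs i with exit-data i
  ... | (x , y) , c , Px , ¬Py = ∈-filter⁺ _ (covers Px ¬Py Exy) (Equivalence.from T-≡ Exy)
    where Exy = Linked⇒related (proj₂ (is-path i)) c

length-arcsIn-++ : ∀ {n} (E : Digraph n) es fs →
  length (arcsIn E (es ++ fs)) ≡ length (arcsIn E es) + length (arcsIn E fs)
length-arcsIn-++ E es fs =
  trans (cong length (filter-++ _ es fs)) (length-++ (arcsIn E es))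

Edge : ∀ {n} → Graph n → Fin n × Fin n → Set
Edge G (x , y) = adj G x y ≡ true

module Oriented {n} (G : Graph n) (D : Digraph n) (orientation : IsOrientation G D) where

  arcsIn-edge : ∀ {x y} → adj G x y ≡ true →
    length (arcsIn D ((x , y) ∷ [])) + length (arcsIn D ((y , x) ∷ [])) ≡ 1
  arcsIn-edge {x} {y} xy with proj₂ orientation x y xy
  ... | inj₁ (Dxy , Dyx) rewrite Dxy | Dyx = refl
  ... | inj₂ (Dxy , Dyx) rewrite Dxy | Dyx = refl

  arcsIn-edges : ∀ {es} → All (Edge G) es →
    length (arcsIn D es) + length (arcsIn D (map swap es)) ≡ length es
  arcsIn-edges [] = refl
  arcsIn-edges {(x , y) ∷ es} (xy ∷ edges) = begin
    length (arcsIn D ((x , y) ∷ es)) + length (arcsIn D ((y , x) ∷ map swap es))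
      ≡⟨ cong₂ _+_ (length-arcsIn-++ D ((x , y) ∷ []) es)
                   (length-arcsIn-++ D ((y , x) ∷ []) (map swap es)) ⟩
    (length (arcsIn D ((x , y) ∷ [])) + length (arcsIn D es))
      + (length (arcsIn D ((y , x) ∷ [])) + length (arcsIn D (map swap es)))
      ≡⟨ interchange +-commutativeSemigroup (length (arcsIn D ((x , y) ∷ []))) _ _ _ ⟩
    (length (arcsIn D ((x , y) ∷ [])) + length (arcsIn D ((y , x) ∷ [])))
      + (length (arcsIn D es) + length (arcsIn D (map swap es)))
      ≡⟨ cong₂ _+_ (arcsIn-edge xy) (arcsIn-edges edges) ⟩
    1 + length es ∎
    where open ≡-Reasoning

sum≤2 : ∀ {k₁ k₂ o i e f} → k₁ ≤ o → k₁ ≤ e → k₂ ≤ i → k₂ ≤ f →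
  o + i ≡ 3 → e + f ≡ 3 → o ≢ e → k₁ + k₂ ≤ 2
sum≤2 {k₁} {k₂} {o} {i} {e} {f} k₁≤o k₁≤e k₂≤i k₂≤f o+i≡3 e+f≡3 o≢e with <-cmp o e
... | tri< o<e _ _ = ≤-pred (begin-strict
  k₁ + k₂ ≤⟨ +-mono-≤ k₁≤o k₂≤f ⟩
  o + f   <⟨ +-monoˡ-< f o<e ⟩
  e + f   ≡⟨ e+f≡3 ⟩
  3       ∎)
  where open ≤-Reasoning
... | tri≈ _ o≡e _ = ⊥-elim (o≢e o≡e)
... | tri> _ _ e<o = ≤-pred (begin-strict
  k₁ + k₂ ≤⟨ +-mono-≤ k₁≤e k₂≤i ⟩
  e + i   <⟨ +-monoˡ-< i e<o ⟩
  o + i   ≡⟨ o+i≡3 ⟩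
  3       ∎)
  where open ≤-Reasoning

double≢3 : ∀ m → m + m ≢ 3
double≢3 zero ()
double≢3 (suc zero) ()
double≢3 (suc (suc m)) eq =
  <⇒≢ (s≤s (s≤s (≤-trans (s≤s (s≤s z≤n)) (m≤n+m (suc (suc m)) m)))) (sym eq)

some-differs : ∀ o₁ o₂ o₃ e → o₁ + o₂ + o₃ ≡ 3 + e → o₁ ≢ e ⊎ o₂ ≢ e ⊎ o₃ ≢ e
some-differs o₁ o₂ o₃ e sum with o₁ ≟ℕ e | o₂ ≟ℕ e | o₃ ≟ℕ e
... | no o₁≢e | _       | _       = inj₁ o₁≢e
... | yes _   | no o₂≢e | _       = inj₂ (inj₁ o₂≢e)
... | yes _   | yes _   | no o₃≢e = inj₂ (inj₂ o₃≢e)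
... | yes refl | yes refl | yes refl = ⊥-elim (double≢3 o₁ (+-cancelʳ-≡ o₁ (o₁ + o₁) 3 sum))

adj-sym : ∀ {n} (G : Graph n) {x y} → adj G x y ≡ true → adj G y x ≡ true
adj-sym G {x} {y} xy = trans (Graph.sym G y x) xy

record Neighbourhood {n} (G : Graph n) (u t₁ t₂ : Fin n) : Set where
  field
    t₁-adj     : adj G u t₁ ≡ true
    t₂-adj     : adj G u t₂ ≡ true
    outer      : Fin n
    outer-adj  : adj G u outer ≡ true
    neighbours : ∀ {y} → adj G u y ≡ true → y ≡ t₁ ⊎ y ≡ t₂ ⊎ y ≡ outer

  star : List (Fin n × Fin n)
  star = (u , t₁) ∷ (u , t₂) ∷ (u , outer) ∷ []

  star-covers : ∀ {y} → adj G u y ≡ true → (u , y) ∈ star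
  star-covers uy with neighbours uy
  ... | inj₁ refl        = here refl
  ... | inj₂ (inj₁ refl) = there (here refl)
  ... | inj₂ (inj₂ refl) = there (there (here refl))

  star-edges : All (Edge G) star
  star-edges = t₁-adj ∷ t₂-adj ∷ outer-adj ∷ []

  outside-is-outer : ∀ {y} → y ≢ t₁ → y ≢ t₂ → adj G u y ≡ true → y ≡ outer
  outside-is-outer y≢t₁ y≢t₂ uy = [ ⊥-elim ∘ y≢t₁ , [ ⊥-elim ∘ y≢t₂ , id ]′ ]′ (neighbours uy)

open Neighbourhood

adj⇒∈neighbours : ∀ {n} (G : Graph n) {u y} → adj G u y ≡ true → y ∈ filterᵇ (adj G u) (allFin n)
adj⇒∈neighbours G {y = y} uy = ∈-filter⁺ _ (∈-allFin y) (Equivalence.from T-≡ uy)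

cubic-neighbourhood : ∀ {n} {G : Graph n} → Cubic G → ∀ {u t₁ t₂} →
  adj G u t₁ ≡ true → adj G u t₂ ≡ true → t₁ ≢ t₂ → Neighbourhood G u t₁ t₂
cubic-neighbourhood {n} {G} cubic {u} ut₁ ut₂ t₁≢t₂
  with third-element _ (cubic u) (adj⇒∈neighbours G ut₁) (adj⇒∈neighbours G ut₂) t₁≢t₂
... | x , x∈N , covers = record
  { t₁-adj     = ut₁
  ; t₂-adj     = ut₂
  ; outer      = x
  ; outer-adj  = Equivalence.to T-≡ (proj₂ (∈-filter⁻ (T? ∘ adj G u) {xs = allFin n} x∈N))
  ; neighbours = covers ∘ adj⇒∈neighbours G
  }

tournament-sum : ∀ ab ba ac ca bc cb xa xb xc → ab + ba ≡ 1 → ac + ca ≡ 1 → bc + cb ≡ 1 →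
  (ab + (ac + xa)) + (ba + (bc + xb)) + (ca + (cb + xc)) ≡ 3 + (xa + (xb + xc))
tournament-sum ab ba ac ca bc cb xa xb xc ab+ba≡1 ac+ca≡1 bc+cb≡1 = begin
  (ab + (ac + xa)) + (ba + (bc + xb)) + (ca + (cb + xc))
    ≡⟨ regroup ab ba ac ca bc cb xa xb xc ⟩
  (ab + ba) + (ac + ca) + (bc + cb) + (xa + (xb + xc))
    ≡⟨ cong (_+ (xa + (xb + xc))) (cong₂ _+_ (cong₂ _+_ ab+ba≡1 ac+ca≡1) bc+cb≡1) ⟩
  3 + (xa + (xb + xc)) ∎
  where
  open ≡-Reasoning
  regroup : ∀ ab ba ac ca bc cb xa xb xc →
    (ab + (ac + xa)) + (ba + (bc + xb)) + (ca + (cb + xc))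
      ≡ (ab + ba) + (ac + ca) + (bc + cb) + (xa + (xb + xc))
  regroup = solve-∀

module Triangle {n} (G : Graph n) (cubic : Cubic G) {a b c : Fin n} (triangle : IsTriangle G a b c)
                (D : Digraph n) (orientation : IsOrientation G D) where

  open Oriented G D orientation

  private
    a≢b : a ≢ b
    a≢b = proj₁ triangle
    b≢c : b ≢ c
    b≢c = proj₁ (proj₂ triangle)
    a≢c : a ≢ c
    a≢c = proj₁ (proj₂ (proj₂ triangle))
    ab : adj G a b ≡ true
    ab = proj₁ (proj₂ (proj₂ (proj₂ triangle)))
    bc : adj G b c ≡ true
    bc = proj₁ (proj₂ (proj₂ (proj₂ (proj₂ triangle))))
    ac : adj G a c ≡ true
    ac = proj₂ (proj₂ (proj₂ (proj₂ (proj₂ triangle))))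

    arc⇒adj : ∀ {x y} → D x y ≡ true → adj G x y ≡ true
    arc⇒adj = proj₁ orientation _ _

  InT : Pred (Fin n) _
  InT y = y ≡ a ⊎ y ≡ b ⊎ y ≡ c

  InT? : Decidable InT
  InT? y = y ≟ a ⊎-dec y ≟ b ⊎-dec y ≟ c

  Na : Neighbourhood G a b c
  Na = cubic-neighbourhood cubic ab ac b≢c

  Nb : Neighbourhood G b a c
  Nb = cubic-neighbourhood cubic (adj-sym G ab) bc a≢c

  Nc : Neighbourhood G c a b
  Nc = cubic-neighbourhood cubic (adj-sym G ac) (adj-sym G bc) a≢b

  cut : List (Fin n × Fin n)
  cut = (a , outer Na) ∷ (b , outer Nb) ∷ (c , outer Nc) ∷ []

  cut-covers : ∀ {x y} → InT x → ¬ InT y → adj G x y ≡ true → (x , y) ∈ cut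
  cut-covers (inj₁ refl) y∉T xy =
    here (cong (a ,_) (outside-is-outer Na (y∉T ∘ inj₂ ∘ inj₁) (y∉T ∘ inj₂ ∘ inj₂) xy))
  cut-covers (inj₂ (inj₁ refl)) y∉T xy =
    there (here (cong (b ,_) (outside-is-outer Nb (y∉T ∘ inj₁) (y∉T ∘ inj₂ ∘ inj₂) xy)))
  cut-covers (inj₂ (inj₂ refl)) y∉T xy =
    there (there (here (cong (c ,_) (outside-is-outer Nc (y∉T ∘ inj₁) (y∉T ∘ inj₂ ∘ inj₁) xy))))

  cut-edges : All (Edge G) cut
  cut-edges = outer-adj Na ∷ outer-adj Nb ∷ outer-adj Nc ∷ []

  bad-corner : ∀ {u t₁ t₂} (N : Neighbourhood G u t₁ t₂) → InT u →
    length (arcsIn D (star N)) ≢ length (arcsIn D cut) → Bad D a b c u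
  bad-corner {u} N u∈T out≢leaving v v≢a v≢b v≢c k₁ k₂ paths-uv paths-vu =
    sum≤2 (disjoint-paths≤cut D (_≟ u) refl v≢u paths-uv (star N) out-of-u)
          (disjoint-paths≤cut D InT? u∈T v∉T paths-uv cut out-of-T)
          (disjoint-paths≤cut D (¬? ∘ (_≟ u)) v≢u (λ u≢u → u≢u refl) paths-vu (map swap (star N)) into-u)
          (disjoint-paths≤cut D (¬? ∘ InT?) v∉T (λ u∉T → u∉T u∈T) paths-vu (map swap cut) into-T)
          (arcsIn-edges (star-edges N))
          (arcsIn-edges cut-edges)
          out≢leaving
    where
    v∉T : ¬ InT v
    v∉T = [ v≢a , [ v≢b , v≢c ]′ ]′

    v≢u : v ≢ u
    v≢u refl = v∉T u∈T

    out-of-u : ∀ {x y} → x ≡ u → ¬ y ≡ u → D x y ≡ true → (x , y) ∈ star N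
    out-of-u refl _ xy = star-covers N (arc⇒adj xy)

    out-of-T : ∀ {x y} → InT x → ¬ InT y → D x y ≡ true → (x , y) ∈ cut
    out-of-T x∈T y∉T xy = cut-covers x∈T y∉T (arc⇒adj xy)

    -- The v→u paths are cut by the complements of {u} and of T, whose leaving arcs enter u and T.
    into-u : ∀ {x y} → x ≢ u → ¬ y ≢ u → D x y ≡ true → (x , y) ∈ map swap (star N)
    into-u {y = y} _ ¬y≢u xy with decidable-stable (y ≟ u) ¬y≢u
    ... | refl = ∈-map⁺ swap (star-covers N (adj-sym G (arc⇒adj xy)))

    into-T : ∀ {x y} → ¬ InT x → ¬ ¬ InT y → D x y ≡ true → (x , y) ∈ map swap cut
    into-T {y = y} x∉T ¬y∉T xy =
      ∈-map⁺ swap (cut-covers (decidable-stable (InT? y) ¬y∉T) x∉T (adj-sym G (arc⇒adj xy)))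

  outdegree-sum : length (arcsIn D (star Na)) + length (arcsIn D (star Nb)) + length (arcsIn D (star Nc))
                ≡ 3 + length (arcsIn D cut)
  outdegree-sum = begin
    length (arcsIn D (star Na)) + length (arcsIn D (star Nb)) + length (arcsIn D (star Nc))
      ≡⟨ cong₂ _+_ (cong₂ _+_ (length-arcsIn₃ (a , b) (a , c) (a , xa)) (length-arcsIn₃ (b , a) (b , c) (b , xb)))
                   (length-arcsIn₃ (c , a) (c , b) (c , xc)) ⟩
    (arcs₁ (a , b) + (arcs₁ (a , c) + arcs₁ (a , xa)))
      + (arcs₁ (b , a) + (arcs₁ (b , c) + arcs₁ (b , xb)))
      + (arcs₁ (c , a) + (arcs₁ (c , b) + arcs₁ (c , xc)))
      ≡⟨ tournament-sum (arcs₁ (a , b)) (arcs₁ (b , a)) (arcs₁ (a , c)) (arcs₁ (c , a))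
                        (arcs₁ (b , c)) (arcs₁ (c , b)) (arcs₁ (a , xa)) (arcs₁ (b , xb)) (arcs₁ (c , xc))
                        (arcsIn-edge (t₁-adj Na)) (arcsIn-edge (t₂-adj Na)) (arcsIn-edge (t₂-adj Nb)) ⟩
    3 + (arcs₁ (a , xa) + (arcs₁ (b , xb) + arcs₁ (c , xc)))
      ≡⟨ cong (3 +_) (sym (length-arcsIn₃ (a , xa) (b , xb) (c , xc))) ⟩
    3 + length (arcsIn D cut) ∎
    where
    open ≡-Reasoning
    xa = outer Na
    xb = outer Nb
    xc = outer Nc
    arcs₁ : Fin n × Fin n → ℕ
    arcs₁ e = length (arcsIn D (e ∷ []))
    length-arcsIn₃ : ∀ e₁ e₂ e₃ → length (arcsIn D (e₁ ∷ e₂ ∷ e₃ ∷ [])) ≡ arcs₁ e₁ + (arcs₁ e₂ + arcs₁ e₃)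
    length-arcsIn₃ e₁ e₂ e₃ =
      trans (length-arcsIn-++ D (e₁ ∷ []) (e₂ ∷ e₃ ∷ []))
            (cong (arcs₁ e₁ +_) (length-arcsIn-++ D (e₂ ∷ []) (e₃ ∷ [])))

lemma3p3 : ∀ {n} (G : Graph n) → Cubic G →
    ∀ (a b c : Fin n) → IsTriangle G a b c →
    ∀ (D : Digraph n) → IsOrientation G D →
    Σ (Fin n) λ u → (u ≡ a ⊎ u ≡ b ⊎ u ≡ c) × Bad D a b c u
lemma3p3 G cubic a b c triangle D orientation =
  case some-differs _ _ _ _ outdegree-sum of λ where
    (inj₁ a-differs)        → a , inj₁ refl        , bad-corner Na (inj₁ refl) a-differs
    (inj₂ (inj₁ b-differs)) → b , inj₂ (inj₁ refl) , bad-corner Nb (inj₂ (inj₁ refl)) b-differs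
    (inj₂ (inj₂ c-differs)) → c , inj₂ (inj₂ refl) , bad-corner Nc (inj₂ (inj₂ refl)) c-differs
  where open Triangle G cubic triangle D orientation
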